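{- Let $x$ be an odd positive integer, let $n\ge 3$ be an integer, and let $s_p\in\{0,2,3,\ldots,4x-1,4x\}$ (i.e. $0\le s_p\le 4x$, $s_p\ne 1$). Then there exists a decomposition of $C_{(4x:n)}$ into $s_p$ $C_{2xn}$-factors and $r_p=4x-s_p$ $C_n$-factors.
   Context: For positive integers $v$ and $k\ge3$, $C_{(v:k)}$ is the graph with vertex set $\{(g,i):0\le g\le v-1,\ i\in\mathbb{Z}_k\}$ in which $(g,i)$ and $(h,j)$ are adjacent iff $i-j\equiv\pm1\pmod k$. A $C_\ell$-factor is a spanning subgraph each of whose components is a cycle of length $\ell$. -}

module Defs where

open import Data.Nat using (ℕ; zero; suc; _+_; _*_; _<_; _%_)
open import Data.Nat.DivMod using (m%n<n)
open import Data.Fin using (Fin; toℕ; fromℕ<)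
open import Data.Product using (Σ; _×_; _,_)
open import Data.Sum using (_⊎_)
open import Relation.Binary.PropositionalEquality using (_≡_)
open import Function.Definitions using (Bijective)

next : ∀ {k} → Fin k → Fin k
next {suc k} i = fromℕ< (m%n<n (suc (toℕ i)) (suc k))

-- Vertex set of C_(v:k):  {(g , i) : 0 ≤ g ≤ v-1 , i ∈ ℤ_k}.
Vtx : ℕ → ℕ → Set
Vtx v k = Fin v × Fin k

Adj : ∀ {v k} → Vtx v k → Vtx v k → Set
Adj (g , i) (h , j) = (i ≡ next j) ⊎ (j ≡ next i)

-- A C_ℓ-factor of a graph on V is a spanning subgraph H each of whose components
-- is a cycle of length ℓ: there are t vertex-disjoint cycles
-- cyc a : Fin ℓ → V (a : Fin t), (cyc a i) adjacent to (cyc a (i+1 mod ℓ)),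
-- which together cover every vertex exactly once (the map (a , i) ↦ cyc a i is a
-- bijection onto V), and the edges of H are exactly the edges of these cycles.
-- (With ℓ ≥ 3 and injectivity of cyc a, each cyc a is a genuine ℓ-cycle.)
IsCycleFactor : {V : Set} → ℕ → (V → V → Set) → Set
IsCycleFactor {V} ℓ H =
  Σ ℕ λ t → Σ (Fin t → Fin ℓ → V) λ cyc →
    Bijective _≡_ _≡_ (λ (p : Fin t × Fin ℓ) → cyc (Data.Product.proj₁ p) (Data.Product.proj₂ p))
    × (∀ u w → H u w ⇔′ (Σ (Fin t) λ a → Σ (Fin ℓ) λ i →
          ((cyc a i ≡ u) × (cyc a (next i) ≡ w)) ⊎ ((cyc a i ≡ w) × (cyc a (next i) ≡ u))))
  where
  _⇔′_ : Set → Set → Set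
  A ⇔′ B = (A → B) × (B → A)

IsDecomposition : {V : Set} → (G : V → V → Set) → (m : ℕ) → (Fin m → V → V → Set) → Set
IsDecomposition {V} G m H =
  (∀ c u w → H c u w → G u w)
  × (∀ u w → G u w → Σ (Fin m) λ c → H c u w × (∀ c′ → H c′ u w → c′ ≡ c))

-- Identify every layer of C_(4x:n) with the abelian group Γ = ℤ₂ × ℤ₂ × ℤ/x and let colour c join
-- (g , i) to (g + φ_c(i) , i + 1) for a voltage φ_c(i) ∈ Γ. If in every layer c ↦ φ_c(i) is a bijection
-- onto Γ, the colour classes decompose C_(4x:n), and colour c is a union of cycles of length n · ord(S_c),
-- where S_c = Σ_i φ_c(i). The voltages are chosen so that S_c = enum c - enum (σ c) for an enumeration
-- enum of Γ and a permutation σ of the colours that fixes every c ≥ s and moves every c < s to c ± 1 (or 2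
-- to 0 when s is odd; no such σ exists for s = 1). Fixed colours give C_n-factors; for the others S_c has
-- order 2x, giving C_{2xn}-factors. Making every layer bijective needs a map ψ with ψ and 1 - ψ both
-- bijective (a complete mapping), which exists because x is odd and Γ contains ℤ₂ × ℤ₂.

module Submission where

open import Defs
open import Algebra.Bundles using (AbelianGroup; CommutativeRing)
import Algebra.Construct.DirectProduct as DirectProduct
open import Data.Bool using (Bool; true; false; not; _xor_)
open import Data.Bool.Properties using (xor-∧-commutativeRing; xor-comm; xor-same; xor-inverseˡ; xor-inverseʳ; not-¬)
open import Data.Fin using (Fin; zero; suc; toℕ; fromℕ<; combine; remQuot; cast; punchOut)
import Data.Fin.Properties as Fin
open import Data.Nat using (ℕ; zero; suc; _+_; _*_; _∸_; _≤_; _<_; _≥_; _%_; _<?_; z≤n; s≤s; s≤s⁻¹)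
open import Data.Nat.DivMod
  using (_/_; _mod_; m≡m%n+[m/n]*n; m<n⇒m%n≡m; n%n≡0; m%n<n; m%n%n≡m%n; [m+kn]%n≡m%n; m*n%n≡0;
         %-distribˡ-+; %-distribˡ-*; +-distrib-/-∣ʳ; m*n/n≡m; m<n*o⇒m/o<n)
open import Data.Nat.Divisibility using (n∣m*n)
open import Data.Nat.GeneralisedArithmetic using (fold; fold-+)
open import Data.Nat.Properties
open import Data.Nat.Tactic.RingSolver using (solve-∀)
open import Data.Product using (Σ; ∃; _×_; _,_; proj₁; proj₂; uncurry; map)
open import Data.Sum using (_⊎_; inj₁; inj₂; swap)
open import Function.Base using (_∘_)
open import Function.Bundles using (Inverse)
open import Function.Definitions using (Injective; Surjective; Bijective)
open import Level using (0ℓ)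
open import Relation.Binary.Definitions using (tri<; tri≈; tri>)
open import Relation.Binary.PropositionalEquality as ≡
  using (_≡_; _≢_; refl; sym; trans; cong; cong₂; subst; module ≡-Reasoning)
import Relation.Binary.Reasoning.Setoid as SetoidReasoning
open import Relation.Nullary using (¬_; yes; no; contradiction)

injective⇒surjective : ∀ {k} {f : Fin k → Fin k} → Injective _≡_ _≡_ f → ∀ y → ∃ λ x → f x ≡ y
injective⇒surjective {suc k} {f} f-inj y with Fin.any? (λ x → f x Fin.≟ y)
... | yes found = found
... | no ∄x = contradiction (Fin.injective⇒≤ punched-inj) (<-irrefl refl)
  where
  punched : Fin (suc k) → Fin k
  punched x = punchOut {i = y} (λ y≡fx → ∄x (x , sym y≡fx))
  punched-inj : Injective _≡_ _≡_ punched
  punched-inj eq = f-inj (Fin.punchOut-injective {i = y} _ _ eq)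

remQuot-injective : ∀ {a} b {i j : Fin (a * b)} → remQuot {a} b i ≡ remQuot b j → i ≡ j
remQuot-injective {a} b {i} {j} eq =
  trans (sym (Fin.combine-remQuot {a} b i)) (trans (cong (uncurry combine) eq) (Fin.combine-remQuot {a} b j))

injective⇒surjective-× : ∀ {a b c d} {f : Fin a × Fin b → Fin c × Fin d} → a * b ≡ c * d →
                         Injective _≡_ _≡_ f → ∀ y → ∃ λ x → f x ≡ y
injective⇒surjective-× {a} {b} {c} {d} {f} ab≡cd f-inj y =
  decode z , combine-injective encoded-z≡y
  where
  combine-injective : ∀ {p q : Fin c × Fin d} → uncurry combine p ≡ uncurry combine q → p ≡ q
  combine-injective {p} {q} eq =
    trans (sym (uncurry Fin.remQuot-combine p)) (trans (cong (remQuot d) eq) (uncurry Fin.remQuot-combine q))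
  decode : Fin (c * d) → Fin a × Fin b
  decode z = remQuot b (cast (sym ab≡cd) z)
  encoded : Fin (c * d) → Fin (c * d)
  encoded z = uncurry combine (f (decode z))
  encoded-injective : Injective _≡_ _≡_ encoded
  encoded-injective {z} {z′} eq = begin
    z                                   ≡⟨ Fin.cast-involutive ab≡cd (sym ab≡cd) z ⟨
    cast ab≡cd (cast (sym ab≡cd) z)     ≡⟨ cong (cast ab≡cd) (remQuot-injective b (f-inj (combine-injective eq))) ⟩
    cast ab≡cd (cast (sym ab≡cd) z′)    ≡⟨ Fin.cast-involutive ab≡cd (sym ab≡cd) z′ ⟩
    z′                                  ∎
    where
    open ≡-Reasoning
  z : Fin (c * d)
  z = proj₁ (injective⇒surjective encoded-injective (uncurry combine y))
  encoded-z≡y : encoded z ≡ uncurry combine y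
  encoded-z≡y = proj₂ (injective⇒surjective encoded-injective (uncurry combine y))

next-cases : ∀ {k} (i : Fin (suc k)) →
             (toℕ i < k × toℕ (next i) ≡ suc (toℕ i)) ⊎ (toℕ i ≡ k × next i ≡ zero)
next-cases {k} i with m≤n⇒m<n∨m≡n (Fin.toℕ≤pred[n] i)
... | inj₁ i<k = inj₁ (i<k , trans (Fin.toℕ-fromℕ< _) (m<n⇒m%n≡m (s≤s i<k)))
... | inj₂ i≡k = inj₂ (i≡k , Fin.toℕ-injective
  (trans (Fin.toℕ-fromℕ< _) (trans (cong (λ j → suc j % suc k) i≡k) (n%n≡0 (suc k)))))

next-fromℕ< : ∀ {k i} (i<1+k : i < suc k) (1+i<1+k : suc i < suc k) → next (fromℕ< i<1+k) ≡ fromℕ< 1+i<1+k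
next-fromℕ< {k} {i} i<1+k 1+i<1+k with next-cases (fromℕ< i<1+k)
... | inj₁ (_ , next≡1+i) = Fin.toℕ-injective (begin
  toℕ (next (fromℕ< i<1+k)) ≡⟨ next≡1+i ⟩
  suc (toℕ (fromℕ< i<1+k))  ≡⟨ cong suc (Fin.toℕ-fromℕ< i<1+k) ⟩
  suc i                     ≡⟨ Fin.toℕ-fromℕ< 1+i<1+k ⟨
  toℕ (fromℕ< 1+i<1+k)      ∎)
  where
  open ≡-Reasoning
... | inj₂ (i≡k , _) = contradiction (trans (sym (Fin.toℕ-fromℕ< i<1+k)) i≡k) (<⇒≢ (s≤s⁻¹ 1+i<1+k))

next-fromℕ<-last : ∀ {k} (k<1+k : k < suc k) → next (fromℕ< k<1+k) ≡ zero
next-fromℕ<-last {k} k<1+k with next-cases (fromℕ< k<1+k)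
... | inj₁ (i<k , _) = contradiction (subst (_< k) (Fin.toℕ-fromℕ< k<1+k) i<k) (<-irrefl refl)
... | inj₂ (_ , next≡0) = next≡0

next-next-≢ : ∀ {k} (i : Fin (3 + k)) → next (next i) ≢ i
next-next-≢ {k} i eq with next-cases i
... | inj₂ (i≡k , next-i≡0) = 0≢1+n (suc-injective (begin
  1                   ≡⟨ cong toℕ (cong next next-i≡0) ⟨
  toℕ (next (next i)) ≡⟨ cong toℕ eq ⟩
  toℕ i               ≡⟨ i≡k ⟩
  2 + k               ∎))
  where
  open ≡-Reasoning
... | inj₁ (i<k , next-i≡1+i) with next-cases (next i)
...   | inj₁ (_ , next²-i≡1+next-i) = m≢1+n+m (toℕ i) (sym (begin
  suc (suc (toℕ i))   ≡⟨ cong suc next-i≡1+i ⟨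
  suc (toℕ (next i))  ≡⟨ next²-i≡1+next-i ⟨
  toℕ (next (next i)) ≡⟨ cong toℕ eq ⟩
  toℕ i               ∎))
  where
  open ≡-Reasoning
...   | inj₂ (next-i≡k , next²-i≡0) = 0≢1+n (suc-injective (begin
  1                  ≡⟨ cong suc (cong toℕ (trans (sym eq) next²-i≡0)) ⟨
  suc (toℕ i)        ≡⟨ next-i≡1+i ⟨
  toℕ (next i)       ≡⟨ next-i≡k ⟩
  2 + k              ∎))
  where
  open ≡-Reasoning

-- Functional graphs

module _ {V : Set} (T : V → V) where

  FunctionalGraph : V → V → Set
  FunctionalGraph u w = T u ≡ w ⊎ T w ≡ u

  fold-next : ∀ {ℓ} z → fold z T ℓ ≡ z → (p : Fin ℓ) → fold z T (toℕ (next p)) ≡ T (fold z T (toℕ p))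
  fold-next {suc ℓ} z periodic p with next-cases p
  ... | inj₁ (_ , next-p≡1+p) = cong (fold z T) next-p≡1+p
  ... | inj₂ (p≡ℓ , next-p≡0) = begin
    fold z T (toℕ (next p)) ≡⟨ cong (λ q → fold z T (toℕ q)) next-p≡0 ⟩
    z                       ≡⟨ periodic ⟨
    T (fold z T ℓ)          ≡⟨ cong (λ q → T (fold z T q)) p≡ℓ ⟨
    T (fold z T (toℕ p))    ∎
    where
    open ≡-Reasoning

  orbits⇒cycleFactor : ∀ {t ℓ} (ρ : Fin t → V) → (∀ a → fold (ρ a) T ℓ ≡ ρ a) →
    Bijective _≡_ _≡_ (λ (p : Fin t × Fin ℓ) → fold (ρ (proj₁ p)) T (toℕ (proj₂ p))) →
    IsCycleFactor ℓ FunctionalGraph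
  orbits⇒cycleFactor {t} {ℓ} ρ periodic (injective , surjective) =
    t , orbit , (injective , surjective) , λ u w → edge⇒step u w , step⇒edge u w
    where
    orbit : Fin t → Fin ℓ → V
    orbit a p = fold (ρ a) T (toℕ p)

    orbit-next : ∀ a p → orbit a (next p) ≡ T (orbit a p)
    orbit-next a = fold-next (ρ a) (periodic a)

    Step : V → V → Set
    Step u w = Σ (Fin t) λ a → Σ (Fin ℓ) λ p →
      ((orbit a p ≡ u) × (orbit a (next p) ≡ w)) ⊎ ((orbit a p ≡ w) × (orbit a (next p) ≡ u))

    step-from : ∀ u w → T u ≡ w → Σ (Fin t) λ a → Σ (Fin ℓ) λ p → (orbit a p ≡ u) × (orbit a (next p) ≡ w)
    step-from u w Tu≡w with (a , p) , orbit-ap≡u ← surjective u =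
      a , p , orbit-ap≡u refl , trans (orbit-next a p) (trans (cong T (orbit-ap≡u refl)) Tu≡w)

    edge⇒step : ∀ u w → FunctionalGraph u w → Step u w
    edge⇒step u w (inj₁ Tu≡w) with a , p , here , there ← step-from u w Tu≡w = a , p , inj₁ (here , there)
    edge⇒step u w (inj₂ Tw≡u) with a , p , here , there ← step-from w u Tw≡u = a , p , inj₂ (here , there)

    step⇒edge : ∀ u w → Step u w → FunctionalGraph u w
    step⇒edge u w (a , p , inj₁ (refl , refl)) = inj₁ (sym (orbit-next a p))
    step⇒edge u w (a , p , inj₂ (refl , refl)) = inj₂ (sym (orbit-next a p))

module GroupFacts {g ℓ} (G : AbelianGroup g ℓ) where
  open AbelianGroup G renaming (refl to ≈-refl; sym to ≈-sym; trans to ≈-trans)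
  open import Algebra.Properties.AbelianGroup G public
  open import Algebra.Properties.CommutativeSemigroup commutativeSemigroup public
  open import Algebra.Properties.Monoid.Mult monoid public
    using () renaming (_×_ to _·_; ×-congʳ to ·-congʳ; ×-homo-+ to ·-homo-+; ×-assocˡ to ·-assocˡ)
  open SetoidReasoning setoid

  xy∙[z-y]≈xz : ∀ a b c → (a ∙ b) ∙ (c - b) ≈ a ∙ c
  xy∙[z-y]≈xz a b c = begin
    (a ∙ b) ∙ (c ∙ b ⁻¹) ≈⟨ assoc a b (c ∙ b ⁻¹) ⟩
    a ∙ (b ∙ (c ∙ b ⁻¹)) ≈⟨ ∙-congˡ (assoc b c (b ⁻¹)) ⟨
    a ∙ (b ∙ c ∙ b ⁻¹)   ≈⟨ ∙-congˡ (xyx⁻¹≈y b c) ⟩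
    a ∙ c                ∎

  x∙[y-x]≈y : ∀ a b → a ∙ (b - a) ≈ b
  x∙[y-x]≈y a b = begin
    a ∙ (b ∙ a ⁻¹) ≈⟨ assoc a b (a ⁻¹) ⟨
    a ∙ b ∙ a ⁻¹   ≈⟨ xyx⁻¹≈y a b ⟩
    b              ∎

  x-[y∙x]≈y⁻¹ : ∀ a b → a - (b ∙ a) ≈ b ⁻¹
  x-[y∙x]≈y⁻¹ a b = begin
    a ∙ (b ∙ a) ⁻¹     ≈⟨ ∙-congˡ (⁻¹-∙-comm b a) ⟨
    a ∙ (b ⁻¹ ∙ a ⁻¹)  ≈⟨ x∙yz≈y∙xz a (b ⁻¹) (a ⁻¹) ⟩
    b ⁻¹ ∙ (a ∙ a ⁻¹)  ≈⟨ ∙-congˡ (inverseʳ a) ⟩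
    b ⁻¹ ∙ ε           ≈⟨ identityʳ (b ⁻¹) ⟩
    b ⁻¹               ∎

  [x-y]-x≈y⁻¹ : ∀ a b → (a - b) - a ≈ b ⁻¹
  [x-y]-x≈y⁻¹ a b = begin
    a ∙ b ⁻¹ ∙ a ⁻¹    ≈⟨ xy∙z≈y∙xz a (b ⁻¹) (a ⁻¹) ⟩
    b ⁻¹ ∙ (a ∙ a ⁻¹)  ≈⟨ ∙-congˡ (inverseʳ a) ⟩
    b ⁻¹ ∙ ε           ≈⟨ identityʳ (b ⁻¹) ⟩
    b ⁻¹               ∎

  ·-⁻¹ : ∀ k g → k · (g ⁻¹) ≈ (k · g) ⁻¹
  ·-⁻¹ zero g = ≈-sym ε⁻¹≈ε
  ·-⁻¹ (suc k) g = begin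
    g ⁻¹ ∙ k · (g ⁻¹) ≈⟨ ∙-congˡ (·-⁻¹ k g) ⟩
    g ⁻¹ ∙ (k · g) ⁻¹ ≈⟨ ⁻¹-∙-comm g (k · g) ⟩
    (g ∙ k · g) ⁻¹    ∎

  ·-ε : ∀ k → k · ε ≈ ε
  ·-ε zero = ≈-refl
  ·-ε (suc k) = ≈-trans (identityˡ _) (·-ε k)

  ·-even-involution : ∀ {g} → g ∙ g ≈ ε → ∀ i → (i * 2) · g ≈ ε
  ·-even-involution {g} g∙g≈ε i = begin
    (i * 2) · g ≈⟨ ·-assocˡ g i 2 ⟨
    i · (2 · g) ≈⟨ ·-congʳ i (≈-trans (∙-congˡ (identityʳ g)) g∙g≈ε) ⟩
    i · ε       ≈⟨ ·-ε i ⟩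
    ε           ∎

  ·-odd-involution : ∀ {g} → g ∙ g ≈ ε → ∀ i → (1 + i * 2) · g ≈ g
  ·-odd-involution {g} g∙g≈ε i = ≈-trans (∙-congˡ (·-even-involution g∙g≈ε i)) (identityʳ g)

  -- If K · S ≈ ε and t * K is the order of the group, r is a transversal of the subgroup ⟨S⟩ of order K.
  Transversal : ∀ {t} → Carrier → (Fin t → Carrier) → ℕ → Set _
  Transversal S r K = ∀ a a′ (k k′ : Fin K) → r a ∙ toℕ k · S ≈ r a′ ∙ toℕ k′ · S → a ≡ a′ × k ≡ k′

  wave : ℕ → Carrier → Carrier
  wave zero g = ε
  wave (suc zero) g = g
  wave (suc (suc i)) g = wave i g

  wave-cases : ∀ i → (∀ g → wave i g ≡ ε) ⊎ (∀ g → wave i g ≡ g)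
  wave-cases zero = inj₁ (λ g → refl)
  wave-cases (suc zero) = inj₂ (λ g → refl)
  wave-cases (suc (suc i)) = wave-cases i

  wave-step : ∀ i → (∀ g → wave (suc i) g - wave i g ≈ g) ⊎ (∀ g → wave (suc i) g - wave i g ≈ g ⁻¹)
  wave-step zero = inj₁ λ g → ≈-trans (∙-congˡ ε⁻¹≈ε) (identityʳ g)
  wave-step (suc zero) = inj₂ λ g → identityˡ (g ⁻¹)
  wave-step (suc (suc i)) = wave-step i

-- Voltage graphs

module VoltageLift {g ℓ} (G : AbelianGroup g ℓ) {m}
                   (code : Inverse (AbelianGroup.setoid G) (≡.setoid (Fin m))) (n′ : ℕ) where
  open AbelianGroup G renaming (refl to ≈-refl; sym to ≈-sym; trans to ≈-trans)
  open GroupFacts G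
  open Inverse code using (to; from; to-cong; strictlyInverseˡ; strictlyInverseʳ)

  n : ℕ
  n = suc n′

  to-injective : ∀ {g h} → to g ≡ to h → g ≈ h
  to-injective {g} {h} eq = begin
    g           ≈⟨ strictlyInverseʳ g ⟨
    from (to g) ≡⟨ cong from eq ⟩
    from (to h) ≈⟨ strictlyInverseʳ h ⟩
    h           ∎
    where
    open SetoidReasoning setoid

  voltage : (ℕ → Carrier) → ℕ → Carrier
  voltage Q i = Q (suc i) - Q i

  -- (v , i) stands for the element from v in layer i. A colour class is the functional graph of lift Q,
  -- which adds the voltage Q (i + 1) - Q i on the way from layer i to layer i + 1; over a full turn the
  -- voltages add up to Q n - Q 0.
  lift : (ℕ → Carrier) → Vtx m n → Vtx m n
  lift Q (v , i) = to (from v ∙ voltage Q (toℕ i)) , next i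

  module _ (Q : ℕ → Carrier) (Q0≈ε : Q 0 ≈ ε) where

    lift-step : ∀ γ (j : Fin n) {i} → toℕ j ≡ i → lift Q (to (γ ∙ Q i) , j) ≡ (to (γ ∙ Q (suc i)) , next j)
    lift-step γ j {.(toℕ j)} refl = cong (_, next j) (to-cong (begin
      from (to (γ ∙ Q (toℕ j))) ∙ voltage Q (toℕ j) ≈⟨ ∙-congʳ (strictlyInverseʳ _) ⟩
      (γ ∙ Q (toℕ j)) ∙ voltage Q (toℕ j)           ≈⟨ xy∙[z-y]≈xz γ (Q (toℕ j)) (Q (suc (toℕ j))) ⟩
      γ ∙ Q (suc (toℕ j))                           ∎))
      where
      open SetoidReasoning setoid

    iterate-lift : ∀ γ i (i<n : i < n) → fold (to γ , zero) (lift Q) i ≡ (to (γ ∙ Q i) , fromℕ< i<n)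
    iterate-lift γ zero _ = cong (_, zero) (to-cong (≈-sym (≈-trans (∙-congˡ Q0≈ε) (identityʳ γ))))
    iterate-lift γ (suc i) 1+i<n = begin
      lift Q (fold (to γ , zero) (lift Q) i)    ≡⟨ cong (lift Q) (iterate-lift γ i i<n) ⟩
      lift Q (to (γ ∙ Q i) , fromℕ< i<n)        ≡⟨ lift-step γ (fromℕ< i<n) (Fin.toℕ-fromℕ< i<n) ⟩
      (to (γ ∙ Q (suc i)) , next (fromℕ< i<n))  ≡⟨ cong (to (γ ∙ Q (suc i)) ,_) (next-fromℕ< i<n 1+i<n) ⟩
      (to (γ ∙ Q (suc i)) , fromℕ< 1+i<n)       ∎
      where
      open ≡-Reasoning
      i<n : i < n
      i<n = <-trans (n<1+n i) 1+i<n

    iterate-lift-period : ∀ γ → fold (to γ , zero) (lift Q) n ≡ (to (γ ∙ Q n) , zero)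
    iterate-lift-period γ = begin
      lift Q (fold (to γ , zero) (lift Q) n′) ≡⟨ cong (lift Q) (iterate-lift γ n′ n′<n) ⟩
      lift Q (to (γ ∙ Q n′) , fromℕ< n′<n)    ≡⟨ lift-step γ (fromℕ< n′<n) (Fin.toℕ-fromℕ< n′<n) ⟩
      (to (γ ∙ Q n) , next (fromℕ< n′<n))     ≡⟨ cong (to (γ ∙ Q n) ,_) (next-fromℕ<-last n′<n) ⟩
      (to (γ ∙ Q n) , zero)                   ∎
      where
      open ≡-Reasoning
      n′<n : n′ < n
      n′<n = n<1+n n′

    iterate-lift-periods : ∀ γ k → fold (to γ , zero) (lift Q) (k * n) ≡ (to (γ ∙ k · Q n) , zero)
    iterate-lift-periods γ zero = cong (_, zero) (to-cong (≈-sym (identityʳ γ)))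
    iterate-lift-periods γ (suc k) = begin
      fold (to γ , zero) (lift Q) (n + k * n)
        ≡⟨ fold-+ (to γ , zero) (lift Q) n ⟩
      fold (fold (to γ , zero) (lift Q) (k * n)) (lift Q) n
        ≡⟨ cong (λ z → fold z (lift Q) n) (iterate-lift-periods γ k) ⟩
      fold (to (γ ∙ k · Q n) , zero) (lift Q) n
        ≡⟨ iterate-lift-period (γ ∙ k · Q n) ⟩
      (to ((γ ∙ k · Q n) ∙ Q n) , zero)
        ≡⟨ cong (_, zero) (to-cong (xy∙z≈x∙zy γ (k · Q n) (Q n))) ⟩
      (to (γ ∙ suc k · Q n) , zero)
        ∎
      where
      open ≡-Reasoning

    iterate-lift-combine : ∀ γ {K} (k : Fin K) (i : Fin n) →
      fold (to γ , zero) (lift Q) (toℕ (combine k i)) ≡ (to ((γ ∙ toℕ k · Q n) ∙ Q (toℕ i)) , i)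
    iterate-lift-combine γ k i = begin
      fold (to γ , zero) (lift Q) (toℕ (combine k i))             ≡⟨ cong (fold (to γ , zero) (lift Q)) position ⟩
      fold (to γ , zero) (lift Q) (toℕ i + toℕ k * n)             ≡⟨ fold-+ (to γ , zero) (lift Q) (toℕ i) ⟩
      fold (fold (to γ , zero) (lift Q) (toℕ k * n)) (lift Q) (toℕ i)
        ≡⟨ cong (λ z → fold z (lift Q) (toℕ i)) (iterate-lift-periods γ (toℕ k)) ⟩
      fold (to (γ ∙ toℕ k · Q n) , zero) (lift Q) (toℕ i)
        ≡⟨ iterate-lift (γ ∙ toℕ k · Q n) (toℕ i) (Fin.toℕ<n i) ⟩
      (to ((γ ∙ toℕ k · Q n) ∙ Q (toℕ i)) , fromℕ< (Fin.toℕ<n i))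
        ≡⟨ cong (to ((γ ∙ toℕ k · Q n) ∙ Q (toℕ i)) ,_) (Fin.fromℕ<-toℕ i (Fin.toℕ<n i)) ⟩
      (to ((γ ∙ toℕ k · Q n) ∙ Q (toℕ i)) , i)
        ∎
      where
      open ≡-Reasoning
      position : toℕ (combine k i) ≡ toℕ i + toℕ k * n
      position = trans (Fin.toℕ-combine k i) (trans (+-comm (n * toℕ k) (toℕ i)) (cong (toℕ i +_) (*-comm n (toℕ k))))

    iterate-lift-injective : ∀ {t K} (r : Fin t → Carrier) → Transversal (Q n) r K →
      Injective _≡_ _≡_ (λ (p : Fin t × Fin (K * n)) → fold (to (r (proj₁ p)) , zero) (lift Q) (toℕ (proj₂ p)))
    iterate-lift-injective {t} {K} r transversal {a , p} {a′ , p′} eq =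
      cong₂ _,_ (proj₁ same-shift) (remQuot-injective n (cong₂ _,_ (proj₂ same-shift) i≡i′))
      where
      k : Fin K
      k = proj₁ (remQuot {K} n p)
      i : Fin n
      i = proj₂ (remQuot {K} n p)
      k′ : Fin K
      k′ = proj₁ (remQuot {K} n p′)
      i′ : Fin n
      i′ = proj₂ (remQuot {K} n p′)
      same-vertex : (to ((r a ∙ toℕ k · Q n) ∙ Q (toℕ i)) , i)
                  ≡ (to ((r a′ ∙ toℕ k′ · Q n) ∙ Q (toℕ i′)) , i′)
      same-vertex = begin
        (to ((r a ∙ toℕ k · Q n) ∙ Q (toℕ i)) , i)
          ≡⟨ iterate-lift-combine (r a) k i ⟨
        fold (to (r a) , zero) (lift Q) (toℕ (combine k i))
          ≡⟨ cong (fold _ (lift Q) ∘ toℕ) (Fin.combine-remQuot {K} n p) ⟩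
        fold (to (r a) , zero) (lift Q) (toℕ p)
          ≡⟨ eq ⟩
        fold (to (r a′) , zero) (lift Q) (toℕ p′)
          ≡⟨ cong (fold _ (lift Q) ∘ toℕ) (Fin.combine-remQuot {K} n p′) ⟨
        fold (to (r a′) , zero) (lift Q) (toℕ (combine k′ i′))
          ≡⟨ iterate-lift-combine (r a′) k′ i′ ⟩
        (to ((r a′ ∙ toℕ k′ · Q n) ∙ Q (toℕ i′)) , i′)
          ∎
        where
        open ≡-Reasoning
      i≡i′ : i ≡ i′
      i≡i′ = cong proj₂ same-vertex
      same-shift : a ≡ a′ × k ≡ k′
      same-shift = transversal a a′ k k′ (∙-cancelʳ (Q (toℕ i)) _ _
        (≈-trans (to-injective (cong proj₁ same-vertex)) (∙-congˡ (reflexive (cong (Q ∘ toℕ) (sym i≡i′))))))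

    liftCycleFactor : ∀ {t K} (r : Fin t → Carrier) → K · Q n ≈ ε → Transversal (Q n) r K → t * K ≡ m →
      IsCycleFactor (K * n) (FunctionalGraph (lift Q))
    liftCycleFactor {t} {K} r K·S≈ε transversal t*K≡m =
      orbits⇒cycleFactor (lift Q) start periodic (iterate-lift-injective r transversal , surjective)
      where
      start : Fin t → Vtx m n
      start a = to (r a) , zero

      periodic : ∀ a → fold (start a) (lift Q) (K * n) ≡ start a
      periodic a = trans (iterate-lift-periods (r a) K)
        (cong (_, zero) (to-cong (≈-trans (∙-congˡ K·S≈ε) (identityʳ (r a)))))

      surjective : Surjective _≡_ _≡_ λ (p : Fin t × Fin (K * n)) → fold (start (proj₁ p)) (lift Q) (toℕ (proj₂ p))
      surjective y = proj₁ preimage , λ { refl → proj₂ preimage }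
        where
        preimage : ∃ λ p → fold (start (proj₁ p)) (lift Q) (toℕ (proj₂ p)) ≡ y
        preimage = injective⇒surjective-× (trans (sym (*-assoc t K n)) (cong (_* n) t*K≡m))
                     (iterate-lift-injective r transversal) y

module _ {g ℓ} (G : AbelianGroup g ℓ) {m}
         (code : Inverse (AbelianGroup.setoid G) (≡.setoid (Fin m))) (n″ : ℕ) where
  open AbelianGroup G renaming (refl to ≈-refl; sym to ≈-sym; trans to ≈-trans)
  open GroupFacts G
  open Inverse code using (to; from; to-cong; strictlyInverseˡ)
  open VoltageLift G code (2 + n″)

  liftDecomposition : (Q : Fin m → ℕ → Carrier) →
    (∀ (i : Fin n) {c c′} → voltage (Q c) (toℕ i) ≈ voltage (Q c′) (toℕ i) → c ≡ c′) →
    IsDecomposition (Adj {m} {n}) m (λ c → FunctionalGraph (lift (Q c)))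
  liftDecomposition Q layer-injective = between-layers , unique-colour
    where
    between-layers : ∀ c u w → FunctionalGraph (lift (Q c)) u w → Adj u w
    between-layers c u w (inj₁ refl) = inj₂ refl
    between-layers c u w (inj₂ refl) = inj₁ refl

    forward : ∀ u w → proj₂ w ≡ next (proj₂ u) →
      Σ (Fin m) λ c → lift (Q c) u ≡ w × (∀ c′ → FunctionalGraph (lift (Q c′)) u w → c′ ≡ c)
    forward (v , i) (w , j) j≡next-i = c , arc , unique
      where
      coded-voltage : Fin m → Fin m
      coded-voltage c = to (voltage (Q c) (toℕ i))
      needed : ∃ λ c → coded-voltage c ≡ to (from w - from v)
      needed = injective⇒surjective (λ eq → layer-injective i (to-injective eq)) (to (from w - from v))
      c : Fin m
      c = proj₁ needed
      arc : lift (Q c) (v , i) ≡ (w , j)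
      arc = cong₂ _,_
        (trans (to-cong (≈-trans (∙-congˡ (to-injective (proj₂ needed))) (x∙[y-x]≈y (from v) (from w))))
               (strictlyInverseˡ w))
        (sym j≡next-i)
      unique : ∀ c′ → FunctionalGraph (lift (Q c′)) (v , i) (w , j) → c′ ≡ c
      unique c′ (inj₁ arc′) =
        layer-injective i (∙-cancelˡ (from v) _ _ (to-injective (trans (cong proj₁ arc′) (sym (cong proj₁ arc)))))
      unique c′ (inj₂ back) = contradiction (trans (cong next (sym j≡next-i)) (cong proj₂ back)) (next-next-≢ i)

    unique-colour : ∀ u w → Adj u w → Σ (Fin m) λ c → FunctionalGraph (lift (Q c)) u w ×
                                        (∀ c′ → FunctionalGraph (lift (Q c′)) u w → c′ ≡ c)
    unique-colour u w (inj₂ j≡next-i) with c , arc , unique ← forward u w j≡next-i = c , inj₁ arc , unique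
    unique-colour u w (inj₁ i≡next-j) with c , arc , unique ← forward w u i≡next-j =
      c , inj₂ arc , λ c′ edge → unique c′ (swap edge)

-- Permutations moving every point to a neighbour

data Adjacent : ℕ → ℕ → Set where
  up   : ∀ {c} → Adjacent c (suc c)
  down : ∀ {c} → Adjacent (suc c) c

adjacent-suc : ∀ {c d} → Adjacent c d → Adjacent (suc c) (suc d)
adjacent-suc up = up
adjacent-suc down = down

data Move : ℕ → ℕ → Set where
  step : ∀ {c d} → Adjacent c d → Move c d
  wrap : Move 2 0

record NeighbourPermutation (s : ℕ) : Set where
  field
    σ         : ℕ → ℕ
    injective : ∀ {c c′} → σ c ≡ σ c′ → c ≡ c′
    fixed     : ∀ {c} → s ≤ c → σ c ≡ c
    stays     : ∀ {c} → c < s → σ c < s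
    moves     : ∀ {c} → c < s → Move c (σ c)

swapBelow : ℕ → ℕ → ℕ
swapBelow zero c = c
swapBelow (suc t) zero = 1
swapBelow (suc t) (suc zero) = 0
swapBelow (suc t) (suc (suc c)) = suc (suc (swapBelow t c))

swapBelow-involutive : ∀ t c → swapBelow t (swapBelow t c) ≡ c
swapBelow-involutive zero c = refl
swapBelow-involutive (suc t) zero = refl
swapBelow-involutive (suc t) (suc zero) = refl
swapBelow-involutive (suc t) (suc (suc c)) = cong (λ d → suc (suc d)) (swapBelow-involutive t c)

swapBelow-fixed : ∀ t {c} → t * 2 ≤ c → swapBelow t c ≡ c
swapBelow-fixed zero _ = refl
swapBelow-fixed (suc t) (s≤s (s≤s 2t≤c)) = cong (λ d → suc (suc d)) (swapBelow-fixed t 2t≤c)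

swapBelow-stays : ∀ t {c} → c < t * 2 → swapBelow t c < t * 2
swapBelow-stays (suc t) {zero} _ = s≤s (s≤s z≤n)
swapBelow-stays (suc t) {suc zero} _ = s≤s z≤n
swapBelow-stays (suc t) {suc (suc c)} (s≤s (s≤s c<2t)) = s≤s (s≤s (swapBelow-stays t c<2t))

swapBelow-adjacent : ∀ t {c} → c < t * 2 → Adjacent c (swapBelow t c)
swapBelow-adjacent (suc t) {zero} _ = up
swapBelow-adjacent (suc t) {suc zero} _ = down
swapBelow-adjacent (suc t) {suc (suc c)} (s≤s (s≤s c<2t)) = adjacent-suc (adjacent-suc (swapBelow-adjacent t c<2t))

swapping : ∀ t → NeighbourPermutation (t * 2)
swapping t = record
  { σ = swapBelow t
  ; injective = λ {c} {c′} eq →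
      trans (sym (swapBelow-involutive t c)) (trans (cong (swapBelow t) eq) (swapBelow-involutive t c′))
  ; fixed = swapBelow-fixed t
  ; stays = swapBelow-stays t
  ; moves = λ c<2t → step (swapBelow-adjacent t c<2t)
  }

rotateSwapBelow : ℕ → ℕ → ℕ
rotateSwapBelow t 0 = 1
rotateSwapBelow t 1 = 2
rotateSwapBelow t 2 = 0
rotateSwapBelow t (suc (suc (suc c))) = 3 + swapBelow t c

rotateSwapBelow⁻¹ : ℕ → ℕ → ℕ
rotateSwapBelow⁻¹ t 0 = 2
rotateSwapBelow⁻¹ t 1 = 0
rotateSwapBelow⁻¹ t 2 = 1
rotateSwapBelow⁻¹ t (suc (suc (suc c))) = 3 + swapBelow t c

rotateSwapBelow-inverse : ∀ t c → rotateSwapBelow⁻¹ t (rotateSwapBelow t c) ≡ c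
rotateSwapBelow-inverse t 0 = refl
rotateSwapBelow-inverse t 1 = refl
rotateSwapBelow-inverse t 2 = refl
rotateSwapBelow-inverse t (suc (suc (suc c))) = cong (3 +_) (swapBelow-involutive t c)

rotating : ∀ t → NeighbourPermutation (3 + t * 2)
rotating t = record
  { σ = rotateSwapBelow t
  ; injective = λ {c} {c′} eq →
      trans (sym (rotateSwapBelow-inverse t c)) (trans (cong (rotateSwapBelow⁻¹ t) eq) (rotateSwapBelow-inverse t c′))
  ; fixed = fixed
  ; stays = stays
  ; moves = moves
  }
  where
  fixed : ∀ {c} → 3 + t * 2 ≤ c → rotateSwapBelow t c ≡ c
  fixed {suc (suc (suc c))} (s≤s (s≤s (s≤s 2t≤c))) = cong (3 +_) (swapBelow-fixed t 2t≤c)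
  stays : ∀ {c} → c < 3 + t * 2 → rotateSwapBelow t c < 3 + t * 2
  stays {0} _ = s≤s (s≤s z≤n)
  stays {1} _ = s≤s (s≤s (s≤s z≤n))
  stays {2} _ = s≤s z≤n
  stays {suc (suc (suc c))} (s≤s (s≤s (s≤s c<2t))) = s≤s (s≤s (s≤s (swapBelow-stays t c<2t)))
  moves : ∀ {c} → c < 3 + t * 2 → Move c (rotateSwapBelow t c)
  moves {0} _ = step up
  moves {1} _ = step up
  moves {2} _ = wrap
  moves {suc (suc (suc c))} (s≤s (s≤s (s≤s c<2t))) =
    step (adjacent-suc (adjacent-suc (adjacent-suc (swapBelow-adjacent t c<2t))))

parity : ∀ s → (∃ λ t → s ≡ t * 2) ⊎ (∃ λ t → s ≡ suc (t * 2))
parity zero = inj₁ (0 , refl)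
parity (suc s) with parity s
... | inj₁ (t , refl) = inj₂ (t , refl)
... | inj₂ (t , refl) = inj₁ (suc t , refl)

neighbourPermutation : ∀ s → s ≢ 1 → NeighbourPermutation s
neighbourPermutation s s≢1 with parity s
... | inj₁ (t , refl) = swapping t
... | inj₂ (zero , refl) = contradiction refl s≢1
... | inj₂ (suc t , refl) = rotating t

-- The groups ℤ₂, ℤ₂ × ℤ₂ and ℤ/x

Z₂ : AbelianGroup 0ℓ 0ℓ
Z₂ = CommutativeRing.+-abelianGroup xor-∧-commutativeRing

Klein : AbelianGroup 0ℓ 0ℓ
Klein = DirectProduct.abelianGroup Z₂ Z₂

module K where
  open AbelianGroup Klein public
  open GroupFacts Klein public
open K using () renaming (_·_ to _·ₖ_; ·-even-involution to ·ₖ-even-involution)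

klein-involution : ∀ v → v K.∙ v K.≈ K.ε
klein-involution (a , b) = xor-same a , xor-same b

ψₖ : Bool × Bool → Bool × Bool
ψₖ (a , b) = (b , a xor b)

ψₖ-nonzero : ∀ v → ¬ v K.≈ K.ε → ¬ ψₖ v K.≈ K.ε
ψₖ-nonzero (false , false) v≉ε _ = v≉ε (refl , refl)
ψₖ-nonzero (false , true) _ (() , _)
ψₖ-nonzero (true , false) _ (_ , ())
ψₖ-nonzero (true , true) _ (() , _)

ψₖ-no-fixpoint : ∀ v → ¬ v K.≈ K.ε → ¬ ψₖ v K.≈ v
ψₖ-no-fixpoint (false , false) v≉ε _ = v≉ε (refl , refl)
ψₖ-no-fixpoint (false , true) _ (() , _)
ψₖ-no-fixpoint (true , false) _ (() , _)
ψₖ-no-fixpoint (true , true) _ (_ , ())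

kleinRep : Bool × Bool → Fin 2 → Bool × Bool
kleinRep v zero = K.ε
kleinRep v (suc zero) = ψₖ v

kleinRep-injective : ∀ {v} → ¬ v K.≈ K.ε → ∀ a a′ → kleinRep v a K.≈ kleinRep v a′ → a ≡ a′
kleinRep-injective _ zero zero _ = refl
kleinRep-injective {v} v≉ε zero (suc zero) eq = contradiction (K.sym eq) (ψₖ-nonzero v v≉ε)
kleinRep-injective {v} v≉ε (suc zero) zero eq = contradiction eq (ψₖ-nonzero v v≉ε)
kleinRep-injective _ (suc zero) (suc zero) _ = refl

kleinRep-avoids : ∀ {v} → ¬ v K.≈ K.ε → ∀ a a′ → ¬ kleinRep v a K.≈ kleinRep v a′ K.∙ v
kleinRep-avoids v≉ε zero zero eq = v≉ε (K.sym eq)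
kleinRep-avoids {v} v≉ε zero (suc zero) eq = ψₖ-no-fixpoint v v≉ε (K.inverseˡ-unique (ψₖ v) v (K.sym eq))
kleinRep-avoids {v} v≉ε (suc zero) zero eq = ψₖ-no-fixpoint v v≉ε eq
kleinRep-avoids {v} v≉ε (suc zero) (suc zero) eq =
  v≉ε (K.sym (K.∙-cancelˡ (ψₖ v) K.ε v (K.trans (K.identityʳ (ψₖ v)) eq)))

open GroupFacts Z₂ using () renaming
  ( _·_ to _·₂_; ·-homo-+ to ·₂-homo-+; ·-odd-involution to ·₂-odd-involution
  ; ∙-cancelˡ to xor-cancelˡ; ∙-cancelʳ to xor-cancelʳ)

odd-shift-flips : ∀ k i → (k + suc (i * 2)) ·₂ true ≢ k ·₂ true
odd-shift-flips k i eq = not-¬ refl (begin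
  k ·₂ true                          ≡⟨ eq ⟨
  (k + suc (i * 2)) ·₂ true          ≡⟨ ·₂-homo-+ true k (suc (i * 2)) ⟩
  k ·₂ true xor suc (i * 2) ·₂ true  ≡⟨ cong (k ·₂ true xor_) (·₂-odd-involution refl i) ⟩
  k ·₂ true xor true                 ≡⟨ xor-comm (k ·₂ true) true ⟩
  not (k ·₂ true)                    ∎)
  where
  open ≡-Reasoning


module Modulus (x′ : ℕ) where
  x : ℕ
  x = suc x′

  infix 4 _≡[mod-x]_
  record _≡[mod-x]_ (a b : ℕ) : Set where
    constructor mod-x
    field residue : a % x ≡ b % x
  open _≡[mod-x]_ public

  +-cong-mod : ∀ {a b c d} → a ≡[mod-x] b → c ≡[mod-x] d → a + c ≡[mod-x] b + d
  +-cong-mod {a} {b} {c} {d} (mod-x a≡b) (mod-x c≡d) = mod-x (begin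
    (a + c) % x           ≡⟨ %-distribˡ-+ a c x ⟩
    (a % x + c % x) % x   ≡⟨ cong₂ (λ u v → (u + v) % x) a≡b c≡d ⟩
    (b % x + d % x) % x   ≡⟨ %-distribˡ-+ b d x ⟨
    (b + d) % x           ∎)
    where
    open ≡-Reasoning

  *-congˡ-mod : ∀ k {a b} → a ≡[mod-x] b → k * a ≡[mod-x] k * b
  *-congˡ-mod k {a} {b} (mod-x a≡b) = mod-x (begin
    (k * a) % x           ≡⟨ %-distribˡ-* k a x ⟩
    (k % x * (a % x)) % x ≡⟨ cong (λ u → (k % x * u) % x) a≡b ⟩
    (k % x * (b % x)) % x ≡⟨ %-distribˡ-* k b x ⟨
    (k * b) % x           ∎)
    where
    open ≡-Reasoning

  inverseˡ-mod : ∀ a → x′ * a + a ≡[mod-x] 0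
  inverseˡ-mod a = mod-x (trans (cong (_% x) (trans (+-comm (x′ * a) a) (*-comm x a))) (m*n%n≡0 a x))

  inverseʳ-mod : ∀ a → a + x′ * a ≡[mod-x] 0
  inverseʳ-mod a = mod-x (trans (cong (_% x) (*-comm x a)) (m*n%n≡0 a x))

  ℤ/x : AbelianGroup 0ℓ 0ℓ
  ℤ/x = record
    { Carrier = ℕ
    ; _≈_ = _≡[mod-x]_
    ; _∙_ = _+_
    ; ε = 0
    ; _⁻¹ = x′ *_ -- x′ * a = (x - 1) * a is the negative of a
    ; isAbelianGroup = record
      { isGroup = record
        { isMonoid = record
          { isSemigroup = record
            { isMagma = record
              { isEquivalence = record
                { refl = mod-x refl
                ; sym = λ (mod-x e) → mod-x (sym e)
                ; trans = λ (mod-x e) (mod-x e′) → mod-x (trans e e′)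
                }
              ; ∙-cong = λ {a} {b} {c} {d} → +-cong-mod {a} {b} {c} {d}
              }
            ; assoc = λ a b c → mod-x (cong (_% x) (+-assoc a b c))
            }
          ; identity = (λ a → mod-x refl) , (λ a → mod-x (cong (_% x) (+-identityʳ a)))
          }
        ; inverse = inverseˡ-mod , inverseʳ-mod
        ; ⁻¹-cong = λ {a} {b} → *-congˡ-mod x′ {a} {b}
        }
      ; comm = λ a b → mod-x (cong (_% x) (+-comm a b))
      }
    }

  module Z where
    open AbelianGroup ℤ/x public
    open GroupFacts ℤ/x public
  open Z public using () renaming (_·_ to _·ₓ_)
  open Z using () renaming (·-⁻¹ to ·ₓ-⁻¹; ·-congʳ to ·ₓ-congʳ)

  ·ₓ≡* : ∀ k y → k ·ₓ y ≡ k * y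
  ·ₓ≡* zero y = refl
  ·ₓ≡* (suc k) y = cong (y +_) (·ₓ≡* k y)

  Generator : ℕ → Set
  Generator y = ∀ k k′ → k ·ₓ y ≡[mod-x] k′ ·ₓ y → k ≡[mod-x] k′

  generator-resp : ∀ {y y′} → y ≡[mod-x] y′ → Generator y → Generator y′
  generator-resp {y} {y′} y≡y′ gen k k′ eq =
    gen k k′ (Z.trans (·ₓ-congʳ k y≡y′) (Z.trans eq (Z.sym (·ₓ-congʳ k′ y≡y′))))

  generator-⁻¹ : ∀ {y} → Generator y → Generator (x′ * y)
  generator-⁻¹ {y} gen k k′ eq =
    gen k k′ (Z.⁻¹-injective (Z.trans (Z.sym (·ₓ-⁻¹ k y)) (Z.trans eq (·ₓ-⁻¹ k′ y))))

  generator-1 : Generator 1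
  generator-1 k k′ eq = mod-x (begin
    k % x             ≡⟨ cong (_% x) (trans (·ₓ≡* k 1) (*-identityʳ k)) ⟨
    (k ·ₓ 1) % x      ≡⟨ residue eq ⟩
    (k′ ·ₓ 1) % x     ≡⟨ cong (_% x) (trans (·ₓ≡* k′ 1) (*-identityʳ k′)) ⟩
    k′ % x            ∎)
    where
    open ≡-Reasoning

  residue-shift : ∀ {k k′} → k % x ≡ k′ % x → k / x ≤ k′ / x → k′ ≡ k + (k′ / x ∸ k / x) * x
  residue-shift {k} {k′} same-residue q≤q′ = begin
    k′                                  ≡⟨ m≡m%n+[m/n]*n k′ x ⟩
    k′ % x + k′ / x * x
      ≡⟨ cong₂ (λ r q → r + q * x) (sym same-residue) (sym (m+[n∸m]≡n q≤q′)) ⟩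
    k % x + (k / x + d) * x             ≡⟨ cong (k % x +_) (*-distribʳ-+ x (k / x) d) ⟩
    k % x + (k / x * x + d * x)         ≡⟨ +-assoc (k % x) (k / x * x) (d * x) ⟨
    k % x + k / x * x + d * x           ≡⟨ cong (_+ d * x) (m≡m%n+[m/n]*n k x) ⟨
    k + d * x                           ∎
    where
    open ≡-Reasoning
    d = k′ / x ∸ k / x

  Γ : AbelianGroup 0ℓ 0ℓ
  Γ = DirectProduct.abelianGroup Klein ℤ/x

  open AbelianGroup Γ renaming (refl to ≈-refl; sym to ≈-sym; trans to ≈-trans; reflexive to ≈-reflexive)
  open GroupFacts Γ

  open Inverse Fin.2↔Bool using () renaming
    (to to toBool; from to fromBool; strictlyInverseˡ to toBool-fromBool; strictlyInverseʳ to fromBool-toBool)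

  encode : Carrier → Fin (4 * x)
  encode ((a , b) , y) = combine (combine (fromBool a) (fromBool b)) (y mod x)

  decode : Fin (4 * x) → Carrier
  decode v = ((toBool (proj₁ high) , toBool (proj₂ high)) , toℕ (proj₂ (remQuot {4} x v)))
    where
    high : Fin 2 × Fin 2
    high = remQuot {2} 2 (proj₁ (remQuot {4} x v))

  encode-cong : ∀ {g h} → g ≈ h → encode g ≡ encode h
  encode-cong {(a , b) , y} {(.a , .b) , y′} ((refl , refl) , mod-x y≡y′) =
    cong (combine (combine (fromBool a) (fromBool b))) (Fin.fromℕ<-cong _ _ y≡y′ (m%n<n y x) (m%n<n y′ x))

  encode-decode : ∀ v → encode (decode v) ≡ v
  encode-decode v = begin
    combine (combine (fromBool (toBool h₁)) (fromBool (toBool h₂))) (toℕ r mod x)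
      ≡⟨ cong₂ (λ u w → combine (combine u w) (toℕ r mod x)) (fromBool-toBool h₁) (fromBool-toBool h₂) ⟩
    combine (combine h₁ h₂) (toℕ r mod x)
      ≡⟨ cong₂ combine (Fin.combine-remQuot {2} 2 q) toℕ-mod ⟩
    combine q r
      ≡⟨ Fin.combine-remQuot {4} x v ⟩
    v ∎
    where
    open ≡-Reasoning
    q : Fin 4
    q = proj₁ (remQuot {4} x v)
    r : Fin x
    r = proj₂ (remQuot {4} x v)
    h₁ h₂ : Fin 2
    h₁ = proj₁ (remQuot {2} 2 q)
    h₂ = proj₂ (remQuot {2} 2 q)
    toℕ-mod : toℕ r mod x ≡ r
    toℕ-mod = Fin.toℕ-injective (trans (Fin.toℕ-fromℕ< _) (m<n⇒m%n≡m (Fin.toℕ<n r)))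

  decode-encode : ∀ g → decode (encode g) ≈ g
  decode-encode ((a , b) , y) = (bit proj₁ a refl , bit proj₂ b refl) , mod-x same-residue
    where
    parts : remQuot {4} x (encode ((a , b) , y)) ≡ (combine (fromBool a) (fromBool b) , y mod x)
    parts = Fin.remQuot-combine _ _
    bits : remQuot {2} 2 (combine (fromBool a) (fromBool b)) ≡ (fromBool a , fromBool b)
    bits = Fin.remQuot-combine _ _
    bit : (select : Fin 2 × Fin 2 → Fin 2) → ∀ c → select (fromBool a , fromBool b) ≡ fromBool c →
          toBool (select (remQuot {2} 2 (proj₁ (remQuot {4} x (encode ((a , b) , y)))))) ≡ c
    bit select c selected = trans (cong (λ p → toBool (select (remQuot {2} 2 (proj₁ p)))) parts)
      (trans (cong (toBool ∘ select) bits) (trans (cong toBool selected) (toBool-fromBool c)))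
    same-residue : toℕ (proj₂ (remQuot {4} x (encode ((a , b) , y)))) % x ≡ y % x
    same-residue = trans (cong (λ p → toℕ (proj₂ p) % x) parts)
      (trans (cong (_% x) (Fin.toℕ-fromℕ< (m%n<n y x))) (m%n%n≡m%n y x))

  decode-cong : ∀ {v w} → v ≡ w → decode v ≈ decode w
  decode-cong {v} refl = ≈-refl {decode v}

  code : Inverse (AbelianGroup.setoid Γ) (≡.setoid (Fin (4 * x)))
  code = record
    { to = encode
    ; from = decode
    ; to-cong = λ {g} {h} → encode-cong {g} {h}
    ; from-cong = decode-cong
    ; inverse = (λ {v} {g} g≈decode-v → trans (encode-cong {g} {decode v} g≈decode-v) (encode-decode v))
              , (λ {g} {v} v≡encode-g →
                   ≈-trans {decode v} {decode (encode g)} {g} (decode-cong v≡encode-g) (decode-encode g))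
    }

  ·-proj₁ : ∀ k g → proj₁ (k · g) ≡ k ·ₖ proj₁ g
  ·-proj₁ zero g = refl
  ·-proj₁ (suc k) g = cong (proj₁ g K.∙_) (·-proj₁ k g)

  ·-proj₂ : ∀ k g → proj₂ (k · g) ≡ k ·ₓ proj₂ g
  ·-proj₂ zero g = refl
  ·-proj₂ (suc k) g = cong (proj₂ g +_) (·-proj₂ k g)


-- The construction for odd x = 1 + 2j

doubling-identity : ∀ c j → c + c * suc (j * 2) ≡ suc j * (c + c)
doubling-identity = solve-∀

tripled : ∀ j → 3 * suc (j * 2) ≡ suc ((1 + j * 3) * 2)
tripled = solve-∀

module OddModulus (j : ℕ) where
  open Modulus (j * 2) public

  -- 2 (1 + j) = x + 1, so 1 + j is an inverse of 2 modulo x.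
  halve : ∀ {a b} → a + a ≡[mod-x] b + b → a ≡[mod-x] b
  halve {a} {b} eq = mod-x (begin
    a % x                 ≡⟨ [m+kn]%n≡m%n a a x ⟨
    (a + a * x) % x       ≡⟨ cong (_% x) (doubling-identity a j) ⟩
    (suc j * (a + a)) % x ≡⟨ residue (*-congˡ-mod (suc j) eq) ⟩
    (suc j * (b + b)) % x ≡⟨ cong (_% x) (doubling-identity b j) ⟨
    (b + b * x) % x       ≡⟨ [m+kn]%n≡m%n b b x ⟩
    b % x                 ∎)
    where
    open ≡-Reasoning

  generator-2 : Generator 2
  generator-2 k k′ eq = halve (mod-x (begin
    (k + k) % x       ≡⟨ cong (_% x) (trans (·ₓ≡* k 2) (twice k)) ⟨
    (k ·ₓ 2) % x      ≡⟨ residue eq ⟩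
    (k′ ·ₓ 2) % x     ≡⟨ cong (_% x) (trans (·ₓ≡* k′ 2) (twice k′)) ⟩
    (k′ + k′) % x     ∎))
    where
    open ≡-Reasoning
    twice : ∀ c → c * 2 ≡ c + c
    twice c = trans (*-comm c 2) (cong (c +_) (+-identityʳ c))

  open AbelianGroup Γ renaming (refl to ≈-refl; sym to ≈-sym; trans to ≈-trans; reflexive to ≈-reflexive)
  open GroupFacts Γ

  enum : ℕ → Carrier
  enum k = ((k ·₂ true , (k / 2) ·₂ true) , k)

  -- Adding x or 3x to k flips the parity of k; adding 2x flips the parity of k / 2.
  enum-shift : ∀ k d → d ≤ 3 → enum (k + d * x) ≈ enum k → d ≡ 0
  enum-shift k 0 _ _ = refl
  enum-shift k 1 _ ((bit₀ , _) , _) =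
    contradiction (trans (cong (λ u → (k + u) ·₂ true) (sym (*-identityˡ x))) bit₀) (odd-shift-flips k j)
  enum-shift k 2 _ ((_ , bit₁) , _) =
    contradiction (trans (cong (_·₂ true) (sym halved)) bit₁) (odd-shift-flips (k / 2) j)
    where
    halved : (k + 2 * x) / 2 ≡ k / 2 + x
    halved = trans (cong (λ u → (k + u) / 2) (*-comm 2 x))
             (trans (+-distrib-/-∣ʳ k (n∣m*n x)) (cong (k / 2 +_) (m*n/n≡m x 2)))
  enum-shift k 3 _ ((bit₀ , _) , _) =
    contradiction (trans (cong (λ u → (k + u) ·₂ true) (sym (tripled j))) bit₀) (odd-shift-flips k (1 + j * 3))
  enum-shift k (suc (suc (suc (suc _)))) (s≤s (s≤s (s≤s ()))) _

  enum-injective-≤ : ∀ {k k′} → k′ < 4 * x → k / x ≤ k′ / x → enum k ≈ enum k′ → k ≡ k′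
  enum-injective-≤ {k} {k′} k′<4x q≤q′ same =
    sym (trans shifted (trans (cong (λ d → k + d * x) no-shift) (+-identityʳ k)))
    where
    shifted : k′ ≡ k + (k′ / x ∸ k / x) * x
    shifted = residue-shift {k} {k′} (residue (proj₂ same)) q≤q′
    no-shift : k′ / x ∸ k / x ≡ 0
    no-shift = enum-shift k (k′ / x ∸ k / x)
      (≤-trans (m∸n≤m (k′ / x) (k / x)) (s≤s⁻¹ (m<n*o⇒m/o<n k′<4x)))
      (≈-trans {enum (k + (k′ / x ∸ k / x) * x)} {enum k′} {enum k}
        (≈-reflexive (cong enum (sym shifted))) (≈-sym {enum k} {enum k′} same))

  enum-injective : ∀ {k k′} → k < 4 * x → k′ < 4 * x → enum k ≈ enum k′ → k ≡ k′
  enum-injective {k} {k′} k<4x k′<4x same with ≤-total (k / x) (k′ / x)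
  ... | inj₁ q≤q′ = enum-injective-≤ k′<4x q≤q′ same
  ... | inj₂ q′≤q = sym (enum-injective-≤ k<4x q′≤q (≈-sym {enum k} {enum k′} same))

  rep : Bool × Bool → Fin 2 → Carrier
  rep v a = (kleinRep v a , 0)

  long-order : ∀ S → (2 * x) · S ≈ ε
  long-order S@(v , y) = klein , mod-x multiple
    where
    klein : proj₁ ((2 * x) · S) K.≈ K.ε
    klein = K.trans (K.reflexive (trans (·-proj₁ (2 * x) S) (cong (_·ₖ v) (*-comm 2 x))))
                    (·ₖ-even-involution {v} (klein-involution v) x)
    multiple : proj₂ ((2 * x) · S) % x ≡ 0 % x
    multiple = trans (cong (_% x) (trans (·-proj₂ (2 * x) S) (trans (·ₓ≡* (2 * x) y) (rearranged y))))
                    (m*n%n≡0 (2 * y) x)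
      where
      rearranged : ∀ y → 2 * x * y ≡ 2 * y * x
      rearranged y = trans (*-assoc 2 x y) (trans (cong (2 *_) (*-comm x y)) (sym (*-assoc 2 y x)))

  -- If the Klein part of S is nonzero and its ℤ/x part generates, S has order 2x and rep (proj₁ S)
  -- represents the two cosets of ⟨S⟩.
  long-transversal-≤ : ∀ {S} → ¬ proj₁ S K.≈ K.ε → Generator (proj₂ S) →
    ∀ a a′ (k k′ : Fin (2 * x)) → toℕ k / x ≤ toℕ k′ / x →
    rep (proj₁ S) a ∙ toℕ k · S ≈ rep (proj₁ S) a′ ∙ toℕ k′ · S → a ≡ a′ × k ≡ k′
  long-transversal-≤ {S@(v , y)} v≉ε generates a a′ k k′ q≤q′ same =
    by-shift (toℕ k′ / x ∸ toℕ k / x) d≤1 (residue-shift {toℕ k} {toℕ k′} same-residue q≤q′)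
    where
    same-klein : kleinRep v a K.∙ toℕ k ·ₖ v K.≈ kleinRep v a′ K.∙ toℕ k′ ·ₖ v
    same-klein = K.trans (K.reflexive (cong (kleinRep v a K.∙_) (sym (·-proj₁ (toℕ k) S))))
      (K.trans (proj₁ same) (K.reflexive (cong (kleinRep v a′ K.∙_) (·-proj₁ (toℕ k′) S))))
    same-residue : toℕ k % x ≡ toℕ k′ % x
    same-residue = residue (generates (toℕ k) (toℕ k′) (mod-x (trans (cong (_% x) (sym (·-proj₂ (toℕ k) S)))
      (trans (residue (proj₂ same)) (cong (_% x) (·-proj₂ (toℕ k′) S))))))
    d≤1 : toℕ k′ / x ∸ toℕ k / x ≤ 1
    d≤1 = ≤-trans (m∸n≤m (toℕ k′ / x) (toℕ k / x)) (s≤s⁻¹ (m<n*o⇒m/o<n (Fin.toℕ<n k′)))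
    by-shift : ∀ d → d ≤ 1 → toℕ k′ ≡ toℕ k + d * x → a ≡ a′ × k ≡ k′
    by-shift zero _ k′≡k+0 =
      kleinRep-injective v≉ε a a′ (K.∙-cancelʳ (toℕ k ·ₖ v) _ _
        (K.trans same-klein (K.reflexive (cong (λ i → kleinRep v a′ K.∙ i ·ₖ v) k′≡k)))) ,
      Fin.toℕ-injective (sym k′≡k)
      where
      k′≡k : toℕ k′ ≡ toℕ k
      k′≡k = trans k′≡k+0 (+-identityʳ (toℕ k))
    by-shift (suc zero) _ k′≡k+x = contradiction (K.∙-cancelʳ (toℕ k ·ₖ v) _ _ (begin
      kleinRep v a K.∙ toℕ k ·ₖ v
        ≈⟨ same-klein ⟩
      kleinRep v a′ K.∙ toℕ k′ ·ₖ v
        ≡⟨ cong (λ i → kleinRep v a′ K.∙ i ·ₖ v) k′≡k+x ⟩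
      kleinRep v a′ K.∙ (toℕ k + 1 * x) ·ₖ v
        ≈⟨ K.∙-congˡ {kleinRep v a′} (K.·-homo-+ v (toℕ k) (1 * x)) ⟩
      kleinRep v a′ K.∙ (toℕ k ·ₖ v K.∙ (1 * x) ·ₖ v)
        ≈⟨ K.∙-congˡ {kleinRep v a′} (K.∙-congˡ {toℕ k ·ₖ v} x·v≈v) ⟩
      kleinRep v a′ K.∙ (toℕ k ·ₖ v K.∙ v)
        ≈⟨ K.x∙yz≈xz∙y (kleinRep v a′) (toℕ k ·ₖ v) v ⟩
      (kleinRep v a′ K.∙ v) K.∙ toℕ k ·ₖ v
        ∎)) (kleinRep-avoids v≉ε a a′)
      where
      open SetoidReasoning K.setoid
      x·v≈v : (1 * x) ·ₖ v K.≈ v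
      x·v≈v = K.trans (K.reflexive (cong (_·ₖ v) (*-identityˡ x))) (K.·-odd-involution (klein-involution v) j)
    by-shift (suc (suc _)) (s≤s ()) _

  long-transversal : ∀ {S} → ¬ proj₁ S K.≈ K.ε → Generator (proj₂ S) → Transversal S (rep (proj₁ S)) (2 * x)
  long-transversal {S} v≉ε generates a a′ k k′ same with ≤-total (toℕ k / x) (toℕ k′ / x)
  ... | inj₁ q≤q′ = long-transversal-≤ v≉ε generates a a′ k k′ q≤q′ same
  ... | inj₂ q′≤q = map sym sym (long-transversal-≤ v≉ε generates a′ a k′ k q′≤q
                      (≈-sym {rep (proj₁ S) a ∙ toℕ k · S} {rep (proj₁ S) a′ ∙ toℕ k′ · S} same))

  move-klein : ∀ {c d} → Move c d → ¬ proj₁ (enum c - enum d) K.≈ K.ε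
  move-klein {c} (step up) (first , _) = contradiction (trans (sym (xor-inverseʳ (c ·₂ true))) first) λ ()
  move-klein {suc d} (step down) (first , _) = contradiction (trans (sym (xor-inverseˡ (d ·₂ true))) first) λ ()
  move-klein wrap (_ , ())

  move-generator : ∀ {c d} → Move c d → Generator (proj₂ (enum c - enum d))
  move-generator {c} (step up) = generator-resp (Z.sym (Z.x-[y∙x]≈y⁻¹ c 1)) (generator-⁻¹ generator-1)
  move-generator {suc d} (step down) = generator-resp (Z.sym (Z.//-rightDividesʳ d 1)) generator-1
  move-generator wrap = generator-resp (mod-x (cong (λ z → (2 + z) % x) (sym (*-zeroʳ (j * 2))))) generator-2

  -- ψ and g ↦ g - ψ g are both injective; no such map exists on the cyclic group ℤ/4x.
  ψ : Carrier → Carrier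
  ψ (v , y) = (ψₖ v , y + y)

  ψ-injective : ∀ {g h} → ψ g ≈ ψ h → g ≈ h
  ψ-injective {(a , b) , y} {(a′ , b′) , y′} ((b≡b′ , ab≡a′b′) , 2y≡2y′) =
    (xor-cancelʳ b a a′ (trans ab≡a′b′ (cong (a′ xor_) (sym b≡b′))) , b≡b′) , halve {y} {y′} 2y≡2y′

  ψ-complement-injective : ∀ {g h} → g - ψ g ≈ h - ψ h → g ≈ h
  ψ-complement-injective {(a , b) , y} {(a′ , b′) , y′} ((ab≡a′b′ , bab≡b′a′b′) , y-2y≡y′-2y′) =
    (a≡a′ , xor-cancelˡ a b b′ (trans ab≡a′b′ (cong (_xor b′) (sym a≡a′)))) ,
    Z.⁻¹-injective (Z.trans (Z.sym (Z.x-[y∙x]≈y⁻¹ y y)) (Z.trans y-2y≡y′-2y′ (Z.x-[y∙x]≈y⁻¹ y′ y′)))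
    where
    xor-back : ∀ a b → b xor (a xor b) ≡ a
    xor-back false false = refl
    xor-back false true = refl
    xor-back true false = refl
    xor-back true true = refl
    a≡a′ : a ≡ a′
    a≡a′ = trans (sym (xor-back a b)) (trans bab≡b′a′b′ (xor-back a′ b′))

  module Colouring (n″ : ℕ) {s} (π : NeighbourPermutation s) (s≤4x : s ≤ 4 * x) where
    open NeighbourPermutation π
    open VoltageLift Γ code (2 + n″)

    -- The potentials of colour c are ε, ψ g, ε, ψ g, … up to layer n - 2, then g and g - enum (σ c), where
    -- g = enum c. In every layer the voltage is then ±ψ g, g, g - ψ g or (enum (σ c))⁻¹, a bijective
    -- function of the colour, and the total voltage is enum c - enum (σ c).
    potential : ℕ → ℕ → Carrier
    potential c i with <-cmp i (2 + n″)
    ... | tri< _ _ _ = wave i (ψ (enum c))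
    ... | tri≈ _ _ _ = enum c
    ... | tri> _ _ _ = enum c - enum (σ c)

    potential-wave : ∀ c {i} → i < 2 + n″ → potential c i ≡ wave i (ψ (enum c))
    potential-wave c {i} i<2+n″ with <-cmp i (2 + n″)
    ... | tri< _ _ _ = refl
    ... | tri≈ i≮2+n″ _ _ = contradiction i<2+n″ i≮2+n″
    ... | tri> i≮2+n″ _ _ = contradiction i<2+n″ i≮2+n″

    potential-top : ∀ c → potential c (2 + n″) ≡ enum c
    potential-top c with <-cmp (2 + n″) (2 + n″)
    ... | tri< _ ≢ _ = contradiction refl ≢
    ... | tri≈ _ _ _ = refl
    ... | tri> _ ≢ _ = contradiction refl ≢

    potential-end : ∀ c → potential c n ≡ enum c - enum (σ c)
    potential-end c with <-cmp n (2 + n″)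
    ... | tri< _ _ n≯n-1 = contradiction (n<1+n (2 + n″)) n≯n-1
    ... | tri≈ _ _ n≯n-1 = contradiction (n<1+n (2 + n″)) n≯n-1
    ... | tri> _ _ _ = refl

    Q : Fin (4 * x) → ℕ → Carrier
    Q c = potential (toℕ c)

    colour-injective : ∀ {c c′ : Fin (4 * x)} → enum (toℕ c) ≈ enum (toℕ c′) → c ≡ c′
    colour-injective {c} {c′} same = Fin.toℕ-injective (enum-injective (Fin.toℕ<n c) (Fin.toℕ<n c′) same)

    voltage-injective : ∀ i (F : Carrier → Carrier) → (∀ c → voltage (Q c) i ≈ F (enum (toℕ c))) →
      (∀ {g h} → F g ≈ F h → g ≈ h) → ∀ {c c′} → voltage (Q c) i ≈ voltage (Q c′) i → c ≡ c′
    voltage-injective i F voltage≈F F-injective {c} {c′} same =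
      colour-injective (F-injective (≈-trans (≈-sym (voltage≈F c)) (≈-trans same (voltage≈F c′))))

    wave-voltage : ∀ c {i} → suc i < 2 + n″ →
      voltage (Q c) i ≡ wave (suc i) (ψ (enum (toℕ c))) - wave i (ψ (enum (toℕ c)))
    wave-voltage c {i} 1+i<2+n″ =
      cong₂ _-_ (potential-wave (toℕ c) 1+i<2+n″) (potential-wave (toℕ c) (<-trans (n<1+n i) 1+i<2+n″))

    wave-layer : ∀ {i} → suc i < 2 + n″ → ∀ {c c′} → voltage (Q c) i ≈ voltage (Q c′) i → c ≡ c′
    wave-layer {i} 1+i<2+n″ with wave-step i
    ... | inj₁ step≈g = voltage-injective i ψ
      (λ c → ≈-trans (≈-reflexive (wave-voltage c 1+i<2+n″)) (step≈g (ψ (enum (toℕ c))))) ψ-injective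
    ... | inj₂ step≈g⁻¹ = voltage-injective i (λ g → ψ g ⁻¹)
      (λ c → ≈-trans (≈-reflexive (wave-voltage c 1+i<2+n″)) (step≈g⁻¹ (ψ (enum (toℕ c)))))
      (ψ-injective ∘ ⁻¹-injective)

    top-layer : ∀ {c c′} → voltage (Q c) (1 + n″) ≈ voltage (Q c′) (1 + n″) → c ≡ c′
    top-layer with wave-cases (1 + n″)
    ... | inj₁ wave≡ε = voltage-injective (1 + n″) (λ g → g)
      (λ c → ≈-trans (≈-reflexive (top-voltage c)) (subtract-ε c)) (λ same → same)
      where
      top-voltage : ∀ c → voltage (Q c) (1 + n″) ≡ enum (toℕ c) - ε
      top-voltage c = cong₂ _-_ (potential-top (toℕ c))
        (trans (potential-wave (toℕ c) (n<1+n (1 + n″))) (wave≡ε (ψ (enum (toℕ c)))))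
      subtract-ε : ∀ c → enum (toℕ c) - ε ≈ enum (toℕ c)
      subtract-ε c = ≈-trans (∙-congˡ {enum (toℕ c)} ε⁻¹≈ε) (identityʳ (enum (toℕ c)))
    ... | inj₂ wave≡g =
      voltage-injective (1 + n″) (λ g → g - ψ g) (λ c → ≈-reflexive (top-voltage c)) ψ-complement-injective
      where
      top-voltage : ∀ c → voltage (Q c) (1 + n″) ≡ enum (toℕ c) - ψ (enum (toℕ c))
      top-voltage c = cong₂ _-_ (potential-top (toℕ c))
        (trans (potential-wave (toℕ c) (n<1+n (1 + n″))) (wave≡g (ψ (enum (toℕ c)))))

    σ-below : ∀ {c} → c < 4 * x → σ c < 4 * x
    σ-below {c} c<4x with c <? s
    ... | yes c<s = <-≤-trans (stays c<s) s≤4x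
    ... | no c≮s = subst (_< 4 * x) (sym (fixed (≮⇒≥ c≮s))) c<4x

    last-layer : ∀ {c c′} → voltage (Q c) (2 + n″) ≈ voltage (Q c′) (2 + n″) → c ≡ c′
    last-layer {c} {c′} same = Fin.toℕ-injective (injective
      (enum-injective (σ-below (Fin.toℕ<n c)) (σ-below (Fin.toℕ<n c′))
        (⁻¹-injective (≈-trans (≈-sym (last-voltage c)) (≈-trans same (last-voltage c′))))))
      where
      last-voltage : ∀ c → voltage (Q c) (2 + n″) ≈ enum (σ (toℕ c)) ⁻¹
      last-voltage c = ≈-trans (≈-reflexive (cong₂ _-_ (potential-end (toℕ c)) (potential-top (toℕ c))))
                               ([x-y]-x≈y⁻¹ (enum (toℕ c)) (enum (σ (toℕ c))))

    layer-injective : ∀ (i : Fin n) {c c′} → voltage (Q c) (toℕ i) ≈ voltage (Q c′) (toℕ i) → c ≡ c′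
    layer-injective i with <-cmp (toℕ i) (1 + n″)
    ... | tri< i<1+n″ _ _ = wave-layer (s≤s i<1+n″)
    ... | tri≈ _ i≡1+n″ _ rewrite i≡1+n″ = top-layer
    ... | tri> _ _ i>1+n″ rewrite ≤-antisym (Fin.toℕ≤pred[n] i) i>1+n″ = last-layer

    long-cycles : ∀ c → toℕ c < s → IsCycleFactor (2 * x * n) (FunctionalGraph (lift (Q c)))
    long-cycles c c<s = liftCycleFactor (Q c) ≈-refl (rep (proj₁ (Q c n))) (long-order (Q c n))
      (long-transversal klein-part generates) (sym (*-assoc 2 2 x))
      where
      klein-part : ¬ proj₁ (Q c n) K.≈ K.ε
      klein-part = subst (λ S → ¬ proj₁ S K.≈ K.ε) (sym (potential-end (toℕ c))) (move-klein (moves c<s))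
      generates : Generator (proj₂ (Q c n))
      generates = subst (Generator ∘ proj₂) (sym (potential-end (toℕ c))) (move-generator (moves c<s))

    short-cycles : ∀ c → s ≤ toℕ c → IsCycleFactor n (FunctionalGraph (lift (Q c)))
    short-cycles c s≤c = subst (λ ℓ → IsCycleFactor ℓ (FunctionalGraph (lift (Q c)))) (*-identityˡ n)
      (liftCycleFactor (Q c) ≈-refl decode order single (*-identityʳ (4 * x)))
      where
      trivial : Q c n ≈ ε
      trivial = ≈-trans
        (≈-reflexive (trans (potential-end (toℕ c)) (cong (λ d → enum (toℕ c) - enum d) (fixed s≤c))))
                        (inverseʳ (enum (toℕ c)))
      order : 1 · Q c n ≈ ε
      order = ≈-trans (identityʳ (Q c n)) trivial
      single : Transversal (Q c n) decode 1
      single a a′ zero zero same = trans (sym (encode-decode a))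
        (trans (encode-cong (≈-trans (≈-sym (identityʳ (decode a))) (≈-trans same (identityʳ (decode a′)))))
               (encode-decode a′)) , refl

    factorisation : Σ (Fin (4 * x) → Vtx (4 * x) n → Vtx (4 * x) n → Set) λ H →
      IsDecomposition (Adj {4 * x} {n}) (4 * x) H
      × (∀ c → (toℕ c < s → IsCycleFactor (2 * x * n) (H c)) × (s ≤ toℕ c → IsCycleFactor n (H c)))
    factorisation = (λ c → FunctionalGraph (lift (Q c))) , liftDecomposition Γ code n″ Q layer-injective ,
                    λ c → long-cycles c , short-cycles c

odd⇒1+2j : ∀ x → x % 2 ≡ 1 → ∃ λ j → x ≡ suc (j * 2)
odd⇒1+2j x x%2≡1 with parity x
... | inj₁ (t , refl) = contradiction (trans (sym (m*n%n≡0 t 2)) x%2≡1) λ ()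
... | inj₂ odd = odd

lemma7p11 : (x n s : ℕ) → x % 2 ≡ 1 → 1 ≤ x → n ≥ 3 → s ≤ 4 * x → ¬ (s ≡ 1) →
    Σ (Fin (4 * x) → Vtx (4 * x) n → Vtx (4 * x) n → Set) λ H →
      IsDecomposition (Adj {4 * x} {n}) (4 * x) H
      × (∀ c → (toℕ c < s → IsCycleFactor (2 * x * n) (H c))
             × (s ≤ toℕ c → IsCycleFactor n (H c)))
-- The hypothesis 1 ≤ x follows from the oddness of x.
lemma7p11 x .(3 + n″) s x-odd _ (s≤s (s≤s (s≤s (z≤n {n″})))) s≤4x s≢1 with odd⇒1+2j x x-odd
... | j , refl = OddModulus.Colouring.factorisation j n″ (neighbourPermutation s s≢1) s≤4x
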